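{- Let $G$ be a nontrivial connected graph and let $w$ be a vertex of $G$. For nonnegative integers $p$ and $q$, let $G(p,q)$ denote the graph obtained from $G$ by attaching to $w$ two pendent paths $P = w v_1 v_2 \ldots v_p$ and $Q = w u_1 u_2 \ldots u_q$ of lengths $p$ and $q$ respectively (the vertices $v_i, u_j$ being new vertices). If $p \geq q \geq 1$, then $$ecc(G(p,q)) < ecc(G(p+1,q-1)).$$
   Context: All graphs are finite, simple and connected. For a connected graph $H$ on vertex set $V$ with $|V|=n$, the eccentricity of a vertex $v$ is $\varepsilon(v)=\max_{u\in V} d(u,v)$, where $d$ is the shortest-path distance, and the average eccentricity is $ecc(H)=\frac{1}{n}\sum_{v\in V}\varepsilon(v)$. -}

module Defs where

open import Data.Bool using (Bool; true; false; _∧_; _∨_; if_then_else_; T)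
open import Data.Nat using (ℕ; zero; suc; _+_; _⊔_; _≡ᵇ_)
open import Data.Fin using (Fin; toℕ; splitAt)
open import Data.Fin.Properties using (_≟_)
open import Data.List using (List; map; foldr; allFin)
open import Data.Bool.ListAction using (any)
open import Data.Nat.ListAction using (sum)
open import Data.Product using (∃)
open import Data.Integer using (+_)
open import Data.Rational using (ℚ; 0ℚ; _/_)
open import Data.Sum using (_⊎_; inj₁; inj₂)
open import Relation.Nullary.Decidable using (⌊_⌋)
open import Relation.Binary.PropositionalEquality using (_≡_)

record Graph : Set where
  field
    n   : ℕ
    adj : Fin n → Fin n → Bool
open Graph public

record Simple (G : Graph) : Set where
  field
    adj-sym    : ∀ u v → adj G u v ≡ adj G v u
    adj-irrefl : ∀ u → adj G u u ≡ false

data Walk (G : Graph) : Fin (n G) → Fin (n G) → ℕ → Set where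
  here : ∀ {u} → Walk G u u 0
  step : ∀ {u w v k} → T (adj G u w) → Walk G w v k → Walk G u v (suc k)

Connected : Graph → Set
Connected G = ∀ u v → ∃ (λ k → Walk G u v k)

reach : (G : Graph) → ℕ → Fin (n G) → Fin (n G) → Bool
reach G zero    u v = ⌊ u ≟ v ⌋
reach G (suc k) u v = reach G k u v ∨ any (λ x → adj G u x ∧ reach G k x v) (allFin (n G))

-- least f b = least k ≤ b with f k = true (or b if there is none).
least : (ℕ → Bool) → ℕ → ℕ
least f zero    = zero
least f (suc b) = if f zero then zero else suc (least (λ k → f (suc k)) b)

-- Shortest-path distance (in a connected graph on n vertices it is < n).
dist : (G : Graph) → Fin (n G) → Fin (n G) → ℕ
dist G u v = least (λ k → reach G k u v) (n G)

eccV : (G : Graph) → Fin (n G) → ℕ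
eccV G v = foldr _⊔_ 0 (map (dist G v) (allFin (n G)))

-- Average eccentricity  ecc(G) = (1/n) Σ_v ε(v)   (0 for the empty graph).
divℕ : ℕ → ℕ → ℚ
divℕ s zero    = 0ℚ
divℕ s (suc m) = (+ s) / suc m

ecc : Graph → ℚ
ecc G = divℕ (sum (map (eccV G) (allFin (n G)))) (n G)

-- G(p,q): vertex set Fin (n + (p + q)); the first n vertices are those of G,
-- index a : Fin p stands for v_(a+1), index b : Fin q stands for u_(b+1).
data Vtx (n p q : ℕ) : Set where
  old : Fin n → Vtx n p q
  vP  : Fin p → Vtx n p q
  vQ  : Fin q → Vtx n p q

classify : ∀ {n p q} → Fin (n + (p + q)) → Vtx n p q
classify {n} {p} x with splitAt n x
... | inj₁ i = old i
... | inj₂ y with splitAt p y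
...   | inj₁ a = vP a
...   | inj₂ b = vQ b

consecutive : ∀ {m} → Fin m → Fin m → Bool
consecutive a b = (toℕ b ≡ᵇ suc (toℕ a)) ∨ (toℕ a ≡ᵇ suc (toℕ b))

attAdj : (G : Graph) → Fin (n G) → (p q : ℕ) → Vtx (n G) p q → Vtx (n G) p q → Bool
attAdj G w p q (old i) (old j) = adj G i j
attAdj G w p q (old i) (vP a)  = ⌊ i ≟ w ⌋ ∧ (toℕ a ≡ᵇ 0)
attAdj G w p q (vP a)  (old i) = ⌊ i ≟ w ⌋ ∧ (toℕ a ≡ᵇ 0)
attAdj G w p q (old i) (vQ b)  = ⌊ i ≟ w ⌋ ∧ (toℕ b ≡ᵇ 0)
attAdj G w p q (vQ b)  (old i) = ⌊ i ≟ w ⌋ ∧ (toℕ b ≡ᵇ 0)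
attAdj G w p q (vP a)  (vP b)  = consecutive a b
attAdj G w p q (vQ a)  (vQ b)  = consecutive a b
attAdj G w p q (vP a)  (vQ b)  = false
attAdj G w p q (vQ b)  (vP a)  = false

attach : (G : Graph) → Fin (n G) → ℕ → ℕ → Graph
attach G w p q = record
  { n   = n G + (p + q)
  ; adj = λ x y → attAdj G w p q (classify x) (classify y)
  }

-- For Q ≤ P every eccentricity of G(P,Q) has a closed form in terms of G: with
-- R = ε_G(w), a vertex x of G has max(ε_G(x), d(x,w) + P), v_i has
-- max(i + R, i + Q, P − i) and u_j has j + max(R, P). Upper bounds are explicit walks
-- through w; lower bounds come from functions that change by at most one along each
-- edge and vanish at a suitable vertex (a vertex of G or the tip of a path), since
-- such a function bounds the distance to its zero.
--
-- Match G(p,q+1) with G(p+1,q) by x ↦ x, v_i ↦ v_(i+1), u_(j+1) ↦ u_j and u_1 ↦ v_1.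
-- No matched eccentricity drops, except that a u_j may lose one. If R ≤ p, each of
-- the at least two vertices of G gains one and only u_1 can lose one; if R > p, each
-- of the p vertices v_i gains one and only the q vertices u_(j+1) can lose one. The
-- orders agree, so the average eccentricity strictly grows.

module Submission where

open import Defs
open import Data.Bool using (Bool; true; false; _∧_; T)
open import Data.Bool.Properties using (T-∧; T-∨)
open import Data.Empty using (⊥-elim)
open import Data.Fin as Fin using (Fin; toℕ; fromℕ<; _↑ˡ_; _↑ʳ_; splitAt; join)
import Data.Fin.Properties as Finₚ
open Finₚ using (_≟_)
open import Data.List using (foldr; map; tabulate; allFin)
open import Data.List.Properties using (map-tabulate; tabulate-cong)
open import Data.List.Relation.Unary.Any using (satisfied)
open import Data.List.Relation.Unary.Any.Properties using (any⁺; any⁻)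
open import Data.List.Membership.Propositional using (lose)
open import Data.List.Membership.Propositional.Properties using (∈-allFin)
open import Data.Nat using (ℕ; zero; suc; _+_; _∸_; _⊔_; _≤_; _<_; z≤n; s≤s; s≤s⁻¹; z<s; _<?_; _≤?_; _≡ᵇ_)
open import Data.Nat.Induction using (<-rec)
open import Data.Nat.Solver using (module +-*-Solver)
open import Data.Nat.ListAction using (sum)
open import Data.Nat.Properties hiding (_≟_)
open import Data.Product using (∃-syntax; _×_; _,_; proj₁; proj₂)
open import Data.Sum using (_⊎_; inj₁; inj₂)
open import Function using (_∘_; id; case_of_; Equivalence)
open import Relation.Nullary using (yes; no)
open import Relation.Nullary.Decidable using (⌊_⌋; toWitness; fromWitness)
open import Relation.Binary.PropositionalEquality
import Data.Integer as ℤ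
import Data.Integer.Properties as ℤₚ
import Data.Rational as ℚ
import Data.Rational.Properties as ℚₚ
open import Data.Rational.Unnormalised using (mkℚᵘ; *<*)
import Data.Rational.Unnormalised.Properties as ℚᵘₚ

open Equivalence using (to; from)

least-≤ : ∀ f b {k} → T (f k) → least f b ≤ k
least-≤ f zero    _ = z≤n
least-≤ f (suc b) {k} fk with f zero in eq
... | true  = z≤n
... | false with k
...   | zero   = ⊥-elim (subst T eq fk)
...   | suc k′ = s≤s (least-≤ (f ∘ suc) b fk)

least-bound-or-hit : ∀ f b → least f b ≡ b ⊎ T (f (least f b))
least-bound-or-hit f zero    = inj₁ refl
least-bound-or-hit f (suc b) with f zero in eq
... | true  = inj₂ (subst T (sym eq) _)
... | false with least-bound-or-hit (f ∘ suc) b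
...   | inj₁ e   = inj₁ (cong suc e)
...   | inj₂ hit = inj₂ hit

-- Finite sums and maxima over Fin

∑ : ∀ {m} → (Fin m → ℕ) → ℕ
∑ f = sum (tabulate f)

sum-map-allFin : ∀ {m} (f : Fin m → ℕ) → sum (map f (allFin m)) ≡ ∑ f
sum-map-allFin f = cong sum (map-tabulate id f)

∑-cong : ∀ {m} {f g : Fin m → ℕ} → (∀ i → f i ≡ g i) → ∑ f ≡ ∑ g
∑-cong f≗g = cong sum (tabulate-cong f≗g)

∑-mono-≤ : ∀ {m} {f g : Fin m → ℕ} → (∀ i → f i ≤ g i) → ∑ f ≤ ∑ g
∑-mono-≤ {zero}  f≤g = z≤n
∑-mono-≤ {suc m} f≤g = +-mono-≤ (f≤g Fin.zero) (∑-mono-≤ (f≤g ∘ Fin.suc))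

∑-↑ : ∀ m {k} (f : Fin (m + k) → ℕ) → ∑ f ≡ ∑ (λ i → f (i ↑ˡ k)) + ∑ (λ j → f (m ↑ʳ j))
∑-↑ zero    f = refl
∑-↑ (suc m) f = trans (cong (f Fin.zero +_) (∑-↑ m (f ∘ Fin.suc))) (sym (+-assoc (f Fin.zero) _ _))

private
  +-+-suc : ∀ a s m → a + s + suc m ≡ suc a + (s + m)
  +-+-suc a s m = trans (+-suc (a + s) m) (cong suc (+-assoc a s m))

∑-<-pointwise : ∀ {m} {f g : Fin m → ℕ} → (∀ i → f i < g i) → ∑ f + m ≤ ∑ g
∑-<-pointwise {zero}  f<g = z≤n
∑-<-pointwise {suc m} {f} f<g = ≤-trans (≤-reflexive (+-+-suc (f Fin.zero) (∑ (f ∘ Fin.suc)) m))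
  (+-mono-≤ (f<g Fin.zero) (∑-<-pointwise (f<g ∘ Fin.suc)))

∑-≤-suc-pointwise : ∀ {m} {f g : Fin m → ℕ} → (∀ i → f i ≤ suc (g i)) → ∑ f ≤ ∑ g + m
∑-≤-suc-pointwise {zero}  f≤g = z≤n
∑-≤-suc-pointwise {suc m} {g = g} f≤g = ≤-trans
  (+-mono-≤ (f≤g Fin.zero) (∑-≤-suc-pointwise (f≤g ∘ Fin.suc)))
  (≤-reflexive (sym (+-+-suc (g Fin.zero) (∑ (g ∘ Fin.suc)) m)))

⊔-tabulate-upper : ∀ {m} (f : Fin m → ℕ) i → f i ≤ foldr _⊔_ 0 (tabulate f)
⊔-tabulate-upper f Fin.zero    = m≤m⊔n _ _
⊔-tabulate-upper f (Fin.suc i) = ≤-trans (⊔-tabulate-upper (f ∘ Fin.suc) i) (m≤n⊔m _ _)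

⊔-tabulate-lub : ∀ {m} (f : Fin m → ℕ) {E} → (∀ i → f i ≤ E) → foldr _⊔_ 0 (tabulate f) ≤ E
⊔-tabulate-lub {zero}  f f≤E = z≤n
⊔-tabulate-lub {suc m} f f≤E = ⊔-lub (f≤E Fin.zero) (⊔-tabulate-lub (f ∘ Fin.suc) (f≤E ∘ Fin.suc))

-- Walks, distances and eccentricities

module Walks (K : Graph) where

  private
    V = Fin (n K)

  _++ʷ_ : ∀ {u v z a b} → Walk K u v a → Walk K v z b → Walk K u z (a + b)
  here       ++ʷ q = q
  step e p   ++ʷ q = step e (p ++ʷ q)

  snoc : ∀ {u v z a} → Walk K u v a → T (adj K v z) → Walk K u z (suc a)
  snoc here       e = step e here
  snoc (step e′ p) e = step e′ (snoc p e)

  walk⇒reach : ∀ {u v k} → Walk K u v k → T (reach K k u v)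
  walk⇒reach here = fromWitness refl
  walk⇒reach (step {w = x} e p) =
    from T-∨ (inj₂ (any⁺ _ (lose (∈-allFin x) (from T-∧ (e , walk⇒reach p)))))

  reach⇒walk : ∀ k {u v} → T (reach K k u v) → ∃[ j ] j ≤ k × Walk K u v j
  reach⇒walk zero r with toWitness r
  ... | refl = 0 , z≤n , here
  reach⇒walk (suc k) {u} {v} r with to T-∨ r
  ... | inj₁ r′ with reach⇒walk k r′
  ...   | j , j≤k , p = j , m≤n⇒m≤1+n j≤k , p
  reach⇒walk (suc k) {u} {v} r | inj₂ r′
    with satisfied (any⁻ (λ x → adj K u x ∧ reach K k x v) (allFin (n K)) r′)
  ...   | x , ex with to T-∧ ex
  ...     | e , r″ with reach⇒walk k r″
  ...       | j , j≤k , p = suc j , s≤s j≤k , step e p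

  dist-≤-length : ∀ {u v k} → Walk K u v k → dist K u v ≤ k
  dist-≤-length p = least-≤ _ (n K) (walk⇒reach p)

  dist-self : ∀ u → dist K u u ≡ 0
  dist-self u = n≤0⇒n≡0 (dist-≤-length here)

  Lipschitz : (V → ℕ) → Set
  Lipschitz f = ∀ a b → T (adj K a b) → f a ≤ suc (f b)

  lipschitz-walk : ∀ {f} → Lipschitz f → ∀ {a b k} → Walk K a b k → f a ≤ k + f b
  lipschitz-walk L here               = ≤-refl
  lipschitz-walk L (step {w = x} e p) = ≤-trans (L _ x e) (s≤s (lipschitz-walk L p))

  eccV≡max : ∀ x → eccV K x ≡ foldr _⊔_ 0 (tabulate (dist K x))
  eccV≡max x = cong (foldr _⊔_ 0) (map-tabulate id (dist K x))

  dist-≤-eccV : ∀ x y → dist K x y ≤ eccV K x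
  dist-≤-eccV x y = subst (dist K x y ≤_) (sym (eccV≡max x)) (⊔-tabulate-upper (dist K x) y)

  eccV-lub : ∀ x {E} → (∀ y → dist K x y ≤ E) → eccV K x ≤ E
  eccV-lub x {E} h = subst (_≤ E) (sym (eccV≡max x)) (⊔-tabulate-lub (dist K x) h)

  +-eccV-lub : ∀ x {k E} → k ≤ E → (∀ y → k + dist K x y ≤ E) → k + eccV K x ≤ E
  +-eccV-lub x {k} {E} k≤E h = subst (_≤ E) (+-comm (eccV K x) k)
    (m≤o∸n⇒m+n≤o (eccV K x) k≤E (eccV-lub x λ y → m+n≤o⇒m≤o∸n _ (subst (_≤ E) (+-comm k _) (h y))))

  vertexAt : ∀ {u v k} → Walk K u v k → ℕ → V
  vertexAt {u} here       _       = u
  vertexAt {u} (step _ p) zero    = u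
  vertexAt     (step _ p) (suc i) = vertexAt p i

  prefix : ∀ {u v k} (p : Walk K u v k) i → i ≤ k → Walk K u (vertexAt p i) i
  prefix here       zero    _       = here
  prefix (step _ p) zero    _       = here
  prefix (step e p) (suc i) (s≤s i≤k) = step e (prefix p i i≤k)

  suffix : ∀ {u v k} (p : Walk K u v k) i → i ≤ k → Walk K (vertexAt p i) v (k ∸ i)
  suffix here       zero    _         = here
  suffix (step e p) zero    _         = step e p
  suffix (step e p) (suc i) (s≤s i≤k) = suffix p i i≤k

  -- A walk of length ≥ n K visits n K + 1 positions, so by pigeonhole it repeats a vertex.
  shortcut : ∀ {u v k} → Walk K u v k → n K ≤ k → ∃[ j ] j < k × Walk K u v j
  shortcut {v = v} {k} p n≤k with Finₚ.pigeonhole (s≤s n≤k) (vertexAt p ∘ toℕ)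
  ... | i , j , i<j , same = toℕ i + (k ∸ toℕ j) , shorter ,
        (prefix p (toℕ i) i≤k ++ʷ subst (λ x → Walk K x v (k ∸ toℕ j)) (sym same) (suffix p (toℕ j) j≤k))
    where
    j≤k : toℕ j ≤ k
    j≤k = s≤s⁻¹ (Finₚ.toℕ<n j)
    i≤k : toℕ i ≤ k
    i≤k = ≤-trans (<⇒≤ i<j) j≤k
    shorter : toℕ i + (k ∸ toℕ j) < k
    shorter = ≤-trans (+-monoˡ-≤ (k ∸ toℕ j) i<j) (≤-reflexive (m+[n∸m]≡n j≤k))

  short-walk : ∀ {u v} k → Walk K u v k → ∃[ j ] j < n K × Walk K u v j
  short-walk {u} {v} = <-rec (λ k → Walk K u v k → ∃[ j ] j < n K × Walk K u v j) shorten
    where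
    shorten : ∀ k → (∀ {j} → j < k → Walk K u v j → ∃[ i ] i < n K × Walk K u v i) →
              Walk K u v k → ∃[ j ] j < n K × Walk K u v j
    shorten k rec p with k <? n K
    ... | yes k<n = k , k<n , p
    ... | no  k≮n with shortcut p (≮⇒≥ k≮n)
    ...   | j , j<k , p′ = rec j<k p′

  module Connectedness (conn : Connected K) where

    -- `least` falls back to its bound n K when no walk is short enough; short-walk rules
    -- that out.
    dist-attained : ∀ u v → T (reach K (dist K u v) u v)
    dist-attained u v with short-walk _ (proj₂ (conn u v))
    ... | j , j<n , p with least-bound-or-hit (λ k → reach K k u v) (n K)
    ...   | inj₂ hit   = hit
    ...   | inj₁ d≡n = ⊥-elim (<-irrefl d≡n (≤-<-trans (dist-≤-length p) j<n))

    geodesic : ∀ u v → ∃[ k ] k ≤ dist K u v × Walk K u v k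
    geodesic u v = reach⇒walk _ (dist-attained u v)

    lipschitz-dist : ∀ {f} → Lipschitz f → ∀ a b → f a ≤ dist K a b + f b
    lipschitz-dist L a b with geodesic a b
    ... | k , k≤d , p = ≤-trans (lipschitz-walk L p) (+-monoˡ-≤ _ k≤d)

    dist-lipschitz : ∀ z → Lipschitz (λ u → dist K u z)
    dist-lipschitz z u u′ e with geodesic u′ z
    ... | k , k≤d , p = ≤-trans (dist-≤-length (step e p)) (s≤s k≤d)

    dist-triangle : ∀ x y z → dist K x z ≤ dist K x y + dist K y z
    dist-triangle x y z with geodesic x y | geodesic y z
    ... | a , a≤ , p | b , b≤ , q = ≤-trans (dist-≤-length (p ++ʷ q)) (+-mono-≤ a≤ b≤)

    eccV-≤-dist+eccV : ∀ x w → eccV K x ≤ dist K x w + eccV K w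
    eccV-≤-dist+eccV x w = eccV-lub x λ y →
      ≤-trans (dist-triangle x w y) (+-monoʳ-≤ (dist K x w) (dist-≤-eccV w y))

-- The graph G(P,Q)

StepLipschitz : ∀ {m} → (Fin m → ℕ) → Set
StepLipschitz f = ∀ a b → T (consecutive a b) → f a ≤ suc (f b)

module _ {m : ℕ} {a b : Fin m} where

  consecutive-up : toℕ b ≡ suc (toℕ a) → T (consecutive a b)
  consecutive-up b≡1+a = from T-∨ (inj₁ (≡⇒≡ᵇ _ _ b≡1+a))

  consecutive-down : toℕ a ≡ suc (toℕ b) → T (consecutive a b)
  consecutive-down a≡1+b = from T-∨ (inj₂ (≡⇒≡ᵇ _ _ a≡1+b))

  consecutive⇒≤suc : T (consecutive a b) → toℕ a ≤ suc (toℕ b)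
  consecutive⇒≤suc c with to T-∨ c
  ... | inj₁ b≡1+a = m≤n⇒m≤1+n (≤-trans (n≤1+n (toℕ a)) (≤-reflexive (sym (≡ᵇ⇒≡ _ _ b≡1+a))))
  ... | inj₂ a≡1+b = ≤-reflexive (≡ᵇ⇒≡ _ _ a≡1+b)

  consecutive⇒suc≥ : T (consecutive a b) → toℕ b ≤ suc (toℕ a)
  consecutive⇒suc≥ c with to T-∨ c
  ... | inj₁ b≡1+a = ≤-reflexive (≡ᵇ⇒≡ _ _ b≡1+a)
  ... | inj₂ a≡1+b = m≤n⇒m≤1+n (≤-trans (n≤1+n (toℕ b)) (≤-reflexive (sym (≡ᵇ⇒≡ _ _ a≡1+b))))

suc+-stepLipschitz : ∀ {m} k → StepLipschitz {m} (λ a → suc (toℕ a) + k)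
suc+-stepLipschitz k a b c = s≤s (+-monoˡ-≤ k (consecutive⇒≤suc c))

∸≤suc∸suc : ∀ k i → k ∸ i ≤ suc (k ∸ suc i)
∸≤suc∸suc zero    zero    = z≤n
∸≤suc∸suc zero    (suc i) = z≤n
∸≤suc∸suc (suc k) zero    = ≤-refl
∸≤suc∸suc (suc k) (suc i) = ∸≤suc∸suc k i

∸suc-stepLipschitz : ∀ {m} k → StepLipschitz {m} (λ a → k ∸ suc (toℕ a))
∸suc-stepLipschitz k a b c =
  ≤-trans (∸≤suc∸suc k (suc (toℕ a))) (s≤s (∸-monoʳ-≤ k (s≤s (consecutive⇒suc≥ c))))

join-splitAt≡ : ∀ m {k} {z : Fin (m + k)} {s} → splitAt m z ≡ s → join m k s ≡ z
join-splitAt≡ m {k} {z} refl = Finₚ.join-splitAt m k z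

lastIndex : ∀ {L} → 0 < L → ∃[ a ] suc (toℕ {L} a) ≡ L
lastIndex {suc L} _ = Fin.fromℕ L , cong suc (Finₚ.toℕ-fromℕ L)

module Attached (G : Graph) (conn : Connected G) (w : Fin (n G)) (P Q : ℕ) where

  H : Graph
  H = attach G w P Q

  V : Set
  V = Vtx (n G) P Q

  _~_ : V → V → Bool
  _~_ = attAdj G w P Q

  R : ℕ
  R = eccV G w

  module WG = Walks G
  module CG = WG.Connectedness conn
  module WH = Walks H

  vertex : V → Fin (n H)
  vertex (old i) = i ↑ˡ (P + Q)
  vertex (vP a)  = n G ↑ʳ (a ↑ˡ Q)
  vertex (vQ b)  = n G ↑ʳ (P ↑ʳ b)

  classify-vertex : ∀ s → classify (vertex s) ≡ s
  classify-vertex (old i) rewrite Finₚ.splitAt-↑ˡ (n G) i (P + Q) = refl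
  classify-vertex (vP a)  rewrite Finₚ.splitAt-↑ʳ (n G) (P + Q) (a ↑ˡ Q) | Finₚ.splitAt-↑ˡ P a Q = refl
  classify-vertex (vQ b)  rewrite Finₚ.splitAt-↑ʳ (n G) (P + Q) (P ↑ʳ b) | Finₚ.splitAt-↑ʳ P Q b = refl

  vertex-classify : ∀ x → vertex (classify x) ≡ x
  vertex-classify x with splitAt (n G) x in split₁
  ... | inj₁ i = join-splitAt≡ (n G) split₁
  ... | inj₂ y with splitAt P y in split₂
  ...   | inj₁ a = trans (cong (n G ↑ʳ_) (join-splitAt≡ P split₂)) (join-splitAt≡ (n G) split₁)
  ...   | inj₂ b = trans (cong (n G ↑ʳ_) (join-splitAt≡ P split₂)) (join-splitAt≡ (n G) split₁)

  edge : ∀ s t → T (s ~ t) → T (adj H (vertex s) (vertex t))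
  edge s t = subst₂ (λ x y → T (x ~ y)) (sym (classify-vertex s)) (sym (classify-vertex t))

  junction-edge : ∀ {m} {a : Fin m} → toℕ a ≡ 0 → T (⌊ w ≟ w ⌋ ∧ (toℕ a ≡ᵇ 0))
  junction-edge a≡0 = from T-∧ (fromWitness refl , ≡⇒≡ᵇ _ 0 a≡0)

  junction-edge⁻¹ : ∀ {i m} {a : Fin m} → T (⌊ i ≟ w ⌋ ∧ (toℕ a ≡ᵇ 0)) → i ≡ w × toℕ a ≡ 0
  junction-edge⁻¹ e with to T-∧ e
  ... | i≡w , a≡0 = toWitness i≡w , ≡ᵇ⇒≡ _ 0 a≡0

  record Route (s t : V) (ℓ : ℕ) : Set where
    constructor route
    field
      length  : ℕ
      length≤ : length ≤ ℓ
      walk    : Walk H (vertex s) (vertex t) length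

  _⨾_ : ∀ {s t u a b} → Route s t a → Route t u b → Route s u (a + b)
  route k k≤ p ⨾ route l l≤ q = route (k + l) (+-mono-≤ k≤ l≤) (p WH.++ʷ q)

  widen : ∀ {s t a b} → a ≤ b → Route s t a → Route s t b
  widen a≤b (route k k≤ p) = route k (≤-trans k≤ a≤b) p

  retarget : ∀ {s s′ t t′ ℓ} → s ≡ s′ → t ≡ t′ → Route s t ℓ → Route s′ t′ ℓ
  retarget refl refl r = r

  geodesicRoute : ∀ x y → Route (old x) (old y) (dist G x y)
  geodesicRoute x y with CG.geodesic x y
  ... | k , k≤ , p = route k k≤ (lift p)
    where
    lift : ∀ {i j k} → Walk G i j k → Walk H (vertex (old i)) (vertex (old j)) k
    lift here       = here
    lift (step e p) = step (edge (old _) (old _) e) (lift p)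

  module Pendant {L : ℕ} (c : Fin L → V)
    (edge-up   : ∀ {a b} → toℕ b ≡ suc (toℕ a) → T (c a ~ c b))
    (edge-down : ∀ {a b} → toℕ a ≡ suc (toℕ b) → T (c a ~ c b))
    (edge-in   : ∀ {a} → toℕ a ≡ 0 → T (old w ~ c a))
    (edge-out  : ∀ {a} → toℕ a ≡ 0 → T (c a ~ old w)) where

    -- Positions on the path are numbers k < L with irrelevant bounds, so that walks
    -- along it can be built by recursion on their length.
    node : (k : ℕ) → .(k < L) → V
    node k k<L = c (fromℕ< k<L)

    node≡ : ∀ k a .(k<L : k < L) → k ≡ toℕ a → node k k<L ≡ c a
    node≡ _ a k<L refl = cong c (Finₚ.fromℕ<-toℕ a k<L)

    private
      pred< : ∀ {i} → suc i < L → i < L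
      pred< = <-trans (n<1+n _)

      node-suc : ∀ i .(i<L : i < L) .(1+i<L : suc i < L) →
                 toℕ (fromℕ< 1+i<L) ≡ suc (toℕ (fromℕ< i<L))
      node-suc i i<L 1+i<L = trans (Finₚ.toℕ-fromℕ< 1+i<L) (cong suc (sym (Finₚ.toℕ-fromℕ< i<L)))

    private
      edge-up-at : ∀ i .(i<L : i < L) .(1+i<L : suc i < L) →
                   T (adj H (vertex (node i i<L)) (vertex (node (suc i) 1+i<L)))
      edge-up-at i i<L 1+i<L = edge (node i i<L) (node (suc i) 1+i<L) (edge-up (node-suc i i<L 1+i<L))

      edge-down-at : ∀ i .(i<L : i < L) .(1+i<L : suc i < L) →
                     T (adj H (vertex (node (suc i) 1+i<L)) (vertex (node i i<L)))
      edge-down-at i i<L 1+i<L = edge (node (suc i) 1+i<L) (node i i<L) (edge-down (node-suc i i<L 1+i<L))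

      edge-in-at : .(0<L : 0 < L) → T (adj H (vertex (old w)) (vertex (node 0 0<L)))
      edge-in-at 0<L = edge (old w) (node 0 0<L) (edge-in (Finₚ.toℕ-fromℕ< 0<L))

      edge-out-at : .(0<L : 0 < L) → T (adj H (vertex (node 0 0<L)) (vertex (old w)))
      edge-out-at 0<L = edge (node 0 0<L) (old w) (edge-out (Finₚ.toℕ-fromℕ< 0<L))

    ascend : ∀ m k .(k<L : k < L) .(m+k<L : m + k < L) →
             Walk H (vertex (node k k<L)) (vertex (node (m + k) m+k<L)) m
    ascend zero    k _   _ = here
    ascend (suc m) k k<L h = WH.snoc (ascend m k k<L (pred< h)) (edge-up-at (m + k) (pred< h) h)

    descend : ∀ m k .(k<L : k < L) .(m+k<L : m + k < L) →
              Walk H (vertex (node (m + k) m+k<L)) (vertex (node k k<L)) m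
    descend zero    k _   _ = here
    descend (suc m) k k<L h = step (edge-down-at (m + k) (pred< h) h) (descend m k k<L (pred< h))

    private
      0<L : Fin L → 0 < L
      0<L a = ≤-<-trans z≤n (Finₚ.toℕ<n a)

      +0<L : (a : Fin L) → toℕ a + 0 < L
      +0<L a = subst (_< L) (sym (+-identityʳ (toℕ a))) (Finₚ.toℕ<n a)

      ∸+<L : (a b : Fin L) → toℕ b ≤ toℕ a → toℕ a ∸ toℕ b + toℕ b < L
      ∸+<L a b b≤a = subst (_< L) (sym (m∸n+n≡m b≤a)) (Finₚ.toℕ<n a)

    enter : ∀ a → Route (old w) (c a) (suc (toℕ a))
    enter a = retarget refl (node≡ _ a (+0<L a) (+-identityʳ (toℕ a)))
      (route _ ≤-refl (step (edge-in-at (0<L a)) (ascend (toℕ a) 0 (0<L a) (+0<L a))))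

    leave : ∀ a → Route (c a) (old w) (suc (toℕ a))
    leave a = retarget (node≡ _ a (+0<L a) (+-identityʳ (toℕ a))) refl
      (route _ ≤-refl (WH.snoc (descend (toℕ a) 0 (0<L a) (+0<L a)) (edge-out-at (0<L a))))

    upward : ∀ a b → toℕ a ≤ toℕ b → Route (c a) (c b) (toℕ b ∸ toℕ a)
    upward a b a≤b = retarget (node≡ _ a (Finₚ.toℕ<n a) refl) (node≡ _ b (∸+<L b a a≤b) (m∸n+n≡m a≤b))
      (route _ ≤-refl (ascend (toℕ b ∸ toℕ a) (toℕ a) (Finₚ.toℕ<n a) (∸+<L b a a≤b)))

    downward : ∀ a b → toℕ b ≤ toℕ a → Route (c a) (c b) (toℕ a ∸ toℕ b)
    downward a b b≤a = retarget (node≡ _ a (∸+<L a b b≤a) (m∸n+n≡m b≤a)) (node≡ _ b (Finₚ.toℕ<n b) refl)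
      (route _ ≤-refl (descend (toℕ a ∸ toℕ b) (toℕ b) (Finₚ.toℕ<n b) (∸+<L a b b≤a)))

  module PathP = Pendant vP consecutive-up consecutive-down junction-edge junction-edge
  module PathQ = Pendant vQ consecutive-up consecutive-down junction-edge junction-edge

  -- The eccentricity of each vertex when Q ≤ P; vP a is v_i and vQ b is u_j for
  -- i = a + 1, j = b + 1.
  eccFormula : V → ℕ
  eccFormula (old x) = eccV G x ⊔ (dist G x w + P)
  eccFormula (vP a)  = (suc (toℕ a) + R) ⊔ ((suc (toℕ a) + Q) ⊔ (P ∸ suc (toℕ a)))
  eccFormula (vQ b)  = suc (toℕ b) + (R ⊔ P)

  module _ (a : Fin P) {k : ℕ} where
    private
      i = suc (toℕ a)

    ≤eccFormula-vP-R : k ≤ i + R → k ≤ eccFormula (vP a)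
    ≤eccFormula-vP-R h = ≤-trans h (m≤m⊔n (i + R) ((i + Q) ⊔ (P ∸ i)))

    ≤eccFormula-vP-Q : k ≤ i + Q → k ≤ eccFormula (vP a)
    ≤eccFormula-vP-Q h = ≤-trans (≤-trans h (m≤m⊔n (i + Q) (P ∸ i))) (m≤n⊔m (i + R) ((i + Q) ⊔ (P ∸ i)))

    ≤eccFormula-vP-P : k ≤ P ∸ i → k ≤ eccFormula (vP a)
    ≤eccFormula-vP-P h = ≤-trans (≤-trans h (m≤n⊔m (i + Q) (P ∸ i))) (m≤n⊔m (i + R) ((i + Q) ⊔ (P ∸ i)))

  route-eccFormula : Q ≤ P → ∀ s t → Route s t (eccFormula s)
  route-eccFormula Q≤P (old x) (old y) =
    widen (m≤n⇒m≤n⊔o _ (WG.dist-≤-eccV x y)) (geodesicRoute x y)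
  route-eccFormula Q≤P (old x) (vP a) =
    widen (m≤n⇒m≤o⊔n _ (+-monoʳ-≤ (dist G x w) (Finₚ.toℕ<n a))) (geodesicRoute x w ⨾ PathP.enter a)
  route-eccFormula Q≤P (old x) (vQ b) =
    widen (m≤n⇒m≤o⊔n _ (+-monoʳ-≤ (dist G x w) (≤-trans (Finₚ.toℕ<n b) Q≤P)))
          (geodesicRoute x w ⨾ PathQ.enter b)
  route-eccFormula Q≤P (vP a) (old y) =
    widen (≤eccFormula-vP-R a (+-monoʳ-≤ (suc (toℕ a)) (WG.dist-≤-eccV w y)))
          (PathP.leave a ⨾ geodesicRoute w y)
  route-eccFormula Q≤P (vP a) (vP b) with toℕ a ≤? toℕ b
  ... | yes a≤b = widen (≤eccFormula-vP-P a (∸-monoˡ-≤ (suc (toℕ a)) (Finₚ.toℕ<n b)))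
                        (PathP.upward a b a≤b)
  ... | no  a≰b = widen (≤eccFormula-vP-R a (≤-trans (m∸n≤m (toℕ a) (toℕ b)) (m≤n⇒m≤1+n (m≤m+n _ R))))
                        (PathP.downward a b (≰⇒≥ a≰b))
  route-eccFormula Q≤P (vP a) (vQ b) =
    widen (≤eccFormula-vP-Q a (+-monoʳ-≤ (suc (toℕ a)) (Finₚ.toℕ<n b))) (PathP.leave a ⨾ PathQ.enter b)
  route-eccFormula Q≤P (vQ b) (old y) =
    widen (+-monoʳ-≤ (suc (toℕ b)) (m≤n⇒m≤n⊔o P (WG.dist-≤-eccV w y))) (PathQ.leave b ⨾ geodesicRoute w y)
  route-eccFormula Q≤P (vQ b) (vP a) =
    widen (+-monoʳ-≤ (suc (toℕ b)) (m≤n⇒m≤o⊔n R (Finₚ.toℕ<n a))) (PathQ.leave b ⨾ PathP.enter a)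
  route-eccFormula Q≤P (vQ b) (vQ b′) =
    widen (+-monoʳ-≤ (suc (toℕ b)) (m≤n⇒m≤o⊔n R (≤-trans (Finₚ.toℕ<n b′) Q≤P)))
          (PathQ.leave b ⨾ PathQ.enter b′)

  walk-eccFormula : Q ≤ P → ∀ x y → ∃[ k ] k ≤ eccFormula (classify x) × Walk H x y k
  walk-eccFormula Q≤P x y with route-eccFormula Q≤P (classify x) (classify y)
  ... | route k k≤ p = k , k≤ , subst₂ (λ u v → Walk H u v k) (vertex-classify x) (vertex-classify y) p

  attach-connected : Q ≤ P → Connected H
  attach-connected Q≤P x y with walk-eccFormula Q≤P x y
  ... | k , _ , p = k , p

  eccV-≤-eccFormula : Q ≤ P → ∀ x → eccV H x ≤ eccFormula (classify x)
  eccV-≤-eccFormula Q≤P x = WH.eccV-lub x λ y → case walk-eccFormula Q≤P x y of λ where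
    (k , k≤ , p) → ≤-trans (WH.dist-≤-length p) k≤

  Lipschitzᵛ : (V → ℕ) → Set
  Lipschitzᵛ F = ∀ s t → T (s ~ t) → F s ≤ suc (F t)

  LipschitzAtJunction : (V → ℕ) → ∀ {m} → (Fin m → V) → Set
  LipschitzAtJunction F c = ∀ a → toℕ a ≡ 0 → F (old w) ≤ suc (F (c a)) × F (c a) ≤ suc (F (old w))

  module _ (F : V → ℕ) (onG : WG.Lipschitz (F ∘ old))
           (junctionP : LipschitzAtJunction F vP) (junctionQ : LipschitzAtJunction F vQ)
           (alongP : StepLipschitz (F ∘ vP)) (alongQ : StepLipschitz (F ∘ vQ)) where

    lipschitz-by-parts : Lipschitzᵛ F
    lipschitz-by-parts (old i) (old j) e = onG i j e
    lipschitz-by-parts (old i) (vP a)  e with junction-edge⁻¹ {i} e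
    ... | refl , a≡0 = proj₁ (junctionP a a≡0)
    lipschitz-by-parts (old i) (vQ b)  e with junction-edge⁻¹ {i} e
    ... | refl , b≡0 = proj₁ (junctionQ b b≡0)
    lipschitz-by-parts (vP a)  (old i) e with junction-edge⁻¹ {i} e
    ... | refl , a≡0 = proj₂ (junctionP a a≡0)
    lipschitz-by-parts (vQ b)  (old i) e with junction-edge⁻¹ {i} e
    ... | refl , b≡0 = proj₂ (junctionQ b b≡0)
    lipschitz-by-parts (vP a)  (vP b)  e = alongP a b e
    lipschitz-by-parts (vQ a)  (vQ b)  e = alongQ a b e

  junction-suc+ : ∀ F {m} (c : Fin m → V) {k} → F (old w) ≡ k → (∀ a → F (c a) ≡ suc (toℕ a) + k) →
                  LipschitzAtJunction F c
  junction-suc+ F c {k} Fw≡k Fc a a≡0 rewrite Fw≡k | Fc a | a≡0 = m≤n⇒m≤1+n (n≤1+n k) , ≤-refl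

  junction-∸ : ∀ F {m} (c : Fin m → V) {k} → F (old w) ≡ k → (∀ a → F (c a) ≡ k ∸ suc (toℕ a)) →
               LipschitzAtJunction F c
  junction-∸ F c {k} Fw≡k Fc a a≡0 rewrite Fw≡k | Fc a | a≡0 = ∸≤suc∸suc k 0 , m≤n⇒m≤1+n (m∸n≤m k 1)

  distToOld : Fin (n G) → V → ℕ
  distToOld y (old x) = dist G x y
  distToOld y (vP a)  = suc (toℕ a) + dist G w y
  distToOld y (vQ b)  = suc (toℕ b) + dist G w y

  distToTipP : V → ℕ
  distToTipP (old x) = dist G x w + P
  distToTipP (vP a)  = P ∸ suc (toℕ a)
  distToTipP (vQ b)  = suc (toℕ b) + P

  distToTipQ : V → ℕ
  distToTipQ (old x) = dist G x w + Q
  distToTipQ (vP a)  = suc (toℕ a) + Q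
  distToTipQ (vQ b)  = Q ∸ suc (toℕ b)

  lipschitz-distToOld : ∀ y → Lipschitzᵛ (distToOld y)
  lipschitz-distToOld y = lipschitz-by-parts (distToOld y) (CG.dist-lipschitz y)
    (junction-suc+ (distToOld y) vP refl λ _ → refl) (junction-suc+ (distToOld y) vQ refl λ _ → refl)
    (suc+-stepLipschitz _) (suc+-stepLipschitz _)

  lipschitz-distToTipP : Lipschitzᵛ distToTipP
  lipschitz-distToTipP = lipschitz-by-parts distToTipP
    (λ i j e → +-monoˡ-≤ P (CG.dist-lipschitz w i j e))
    (junction-∸ distToTipP vP (cong (_+ P) (WG.dist-self w)) λ _ → refl)
    (junction-suc+ distToTipP vQ (cong (_+ P) (WG.dist-self w)) λ _ → refl)
    (∸suc-stepLipschitz P) (suc+-stepLipschitz P)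

  lipschitz-distToTipQ : Lipschitzᵛ distToTipQ
  lipschitz-distToTipQ = lipschitz-by-parts distToTipQ
    (λ i j e → +-monoˡ-≤ Q (CG.dist-lipschitz w i j e))
    (junction-suc+ distToTipQ vP (cong (_+ Q) (WG.dist-self w)) λ _ → refl)
    (junction-∸ distToTipQ vQ (cong (_+ Q) (WG.dist-self w)) λ _ → refl)
    (suc+-stepLipschitz Q) (∸suc-stepLipschitz Q)

  lipschitz-≤-eccV : Q ≤ P → ∀ {F} → Lipschitzᵛ F → ∀ t → F t ≡ 0 → ∀ x → F (classify x) ≤ eccV H x
  lipschitz-≤-eccV Q≤P {F} L t Ft≡0 x = begin
    F (classify x)                                ≤⟨ CH.lipschitz-dist L′ x (vertex t) ⟩
    dist H x (vertex t) + F (classify (vertex t)) ≡⟨ cong (dist H x (vertex t) +_) F[t]≡0 ⟩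
    dist H x (vertex t) + 0                       ≡⟨ +-identityʳ _ ⟩
    dist H x (vertex t)                           ≤⟨ WH.dist-≤-eccV x (vertex t) ⟩
    eccV H x                                      ∎
    where
    open ≤-Reasoning
    module CH = WH.Connectedness (attach-connected Q≤P)
    L′ : WH.Lipschitz (F ∘ classify)
    L′ a b = L (classify a) (classify b)
    F[t]≡0 : F (classify (vertex t)) ≡ 0
    F[t]≡0 = trans (cong F (classify-vertex t)) Ft≡0

  eccFormula-≤ : ∀ s {E} → (∀ y → distToOld y s ≤ E) → distToTipP s ≤ E → (0 < Q → distToTipQ s ≤ E) →
                 eccFormula s ≤ E
  eccFormula-≤ (old x) toOld toTipP _ = ⊔-lub (WG.eccV-lub x toOld) toTipP
  eccFormula-≤ (vP a) {E} toOld toTipP toTipQ = ⊔-lub viaG (⊔-lub viaQ toTipP)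
    where
    viaG : suc (toℕ a) + R ≤ E
    viaG = WG.+-eccV-lub w (m+n≤o⇒m≤o _ (toOld w)) toOld
    viaQ : suc (toℕ a) + Q ≤ E
    viaQ with 0 <? Q
    ... | yes 0<Q = toTipQ 0<Q
    ... | no  0≮Q = ≤-trans (+-monoʳ-≤ _ (subst (_≤ R) (sym (n≤0⇒n≡0 (≮⇒≥ 0≮Q))) z≤n)) viaG
  eccFormula-≤ (vQ b) {E} toOld toTipP _ = subst (_≤ E) (sym (+-distribˡ-⊔ (suc (toℕ b)) R P))
    (⊔-lub (WG.+-eccV-lub w (m+n≤o⇒m≤o _ (toOld w)) toOld) toTipP)

  eccFormula-≤-eccV : Q ≤ P → 0 < P → ∀ x → eccFormula (classify x) ≤ eccV H x
  eccFormula-≤-eccV Q≤P 0<P x = eccFormula-≤ (classify x)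
    (λ y → atLeast (lipschitz-distToOld y) (old y) (WG.dist-self y))
    (atLeast lipschitz-distToTipP (vP (proj₁ (lastIndex 0<P))) (tip (proj₂ (lastIndex 0<P))))
    (λ 0<Q → atLeast lipschitz-distToTipQ (vQ (proj₁ (lastIndex 0<Q))) (tip (proj₂ (lastIndex 0<Q))))
    where
    atLeast : ∀ {F} → Lipschitzᵛ F → ∀ t → F t ≡ 0 → F (classify x) ≤ eccV H x
    atLeast L t Ft≡0 = lipschitz-≤-eccV Q≤P L t Ft≡0 x
    tip : ∀ {i k} → suc i ≡ k → k ∸ suc i ≡ 0
    tip {k = k} e = trans (cong (k ∸_) e) (n∸n≡0 k)

  eccSum : ℕ
  eccSum = sum (map (eccV H) (allFin (n H)))

  formulaSum : ℕ
  formulaSum = ∑ (eccFormula ∘ old) + (∑ (eccFormula ∘ vP) + ∑ (eccFormula ∘ vQ))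

  ∑-classify : ∀ (f : V → ℕ) → ∑ (f ∘ classify) ≡ ∑ (f ∘ old) + (∑ (f ∘ vP) + ∑ (f ∘ vQ))
  ∑-classify f = trans (∑-↑ (n G) (f ∘ classify)) (cong₂ _+_ (∑-cong (at old))
    (trans (∑-↑ P _) (cong₂ _+_ (∑-cong (at vP)) (∑-cong (at vQ)))))
    where
    at : ∀ {A : Set} (c : A → V) i → f (classify (vertex (c i))) ≡ f (c i)
    at c i = cong f (classify-vertex (c i))

  eccSum-≤-formulaSum : Q ≤ P → eccSum ≤ formulaSum
  eccSum-≤-formulaSum Q≤P = subst₂ _≤_ (sym (sum-map-allFin (eccV H))) (∑-classify eccFormula)
    (∑-mono-≤ (eccV-≤-eccFormula Q≤P))

  formulaSum-≤-eccSum : Q ≤ P → 0 < P → formulaSum ≤ eccSum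
  formulaSum-≤-eccSum Q≤P 0<P = subst₂ _≤_ (∑-classify eccFormula) (sym (sum-map-allFin (eccV H)))
    (∑-mono-≤ (eccFormula-≤-eccV Q≤P 0<P))

-- From G(p,q+1) to G(p+1,q)

-- The four blocks are the sums over G, over P, the junction vertex, and over the rest
-- of Q, grouped as formulaSum groups them; each block carries its own slack.
+-<-blocks : ∀ {g s a t g′ b s′ t′} k₁ k₂ k₃ → g + k₁ ≤ g′ → s + k₂ ≤ s′ → t ≤ t′ + k₃ →
             a + k₃ < k₁ + k₂ + b → g + (s + (a + t)) < g′ + ((b + s′) + t′)
+-<-blocks {g} {s} {a} {t} {g′} {b} {s′} {t′} k₁ k₂ k₃ hg hs ht ha = begin
  suc (g + (s + (a + t)))         ≤⟨ s≤s (+-monoʳ-≤ g (+-monoʳ-≤ s (+-monoʳ-≤ a ht))) ⟩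
  suc (g + (s + (a + (t′ + k₃)))) ≡⟨ regroup₁ g s a t′ k₃ ⟩
  g + (s + (suc (a + k₃) + t′))   ≤⟨ +-monoʳ-≤ g (+-monoʳ-≤ s (+-monoˡ-≤ t′ ha)) ⟩
  g + (s + ((k₁ + k₂ + b) + t′))  ≡⟨ regroup₂ g s k₁ k₂ b t′ ⟩
  (g + k₁) + ((b + (s + k₂)) + t′) ≤⟨ +-mono-≤ hg (+-monoˡ-≤ t′ (+-monoʳ-≤ b hs)) ⟩
  g′ + ((b + s′) + t′)            ∎
  where
  open ≤-Reasoning
  open +-*-Solver
  regroup₁ = solve 5 (λ g s a t′ k₃ → con 1 :+ (g :+ (s :+ (a :+ (t′ :+ k₃))))
                                    := g :+ (s :+ ((con 1 :+ (a :+ k₃)) :+ t′))) refl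
  regroup₂ = solve 6 (λ g s k₁ k₂ b t′ → g :+ (s :+ ((k₁ :+ k₂ :+ b) :+ t′))
                                       := (g :+ k₁) :+ ((b :+ (s :+ k₂)) :+ t′)) refl

module PendantShift (G : Graph) (conn : Connected G) (w : Fin (n G)) (p q : ℕ) (q<p : q < p) where

  module A = Attached G conn w p (suc q)
  module B = Attached G conn w (suc p) q
  open A using (R)

  eccFormula-old-≤ : ∀ x → A.eccFormula (old x) ≤ B.eccFormula (old x)
  eccFormula-old-≤ x = ⊔-monoʳ-≤ (eccV G x) (+-monoʳ-≤ (dist G x w) (n≤1+n p))

  eccFormula-old-< : R ≤ p → ∀ x → A.eccFormula (old x) < B.eccFormula (old x)
  eccFormula-old-< R≤p x = ≤-trans (s≤s (⊔-lub eccV≤ ≤-refl))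
    (≤-trans (≤-reflexive (sym (+-suc (dist G x w) p))) (m≤n⊔m (eccV G x) _))
    where
    eccV≤ : eccV G x ≤ dist G x w + p
    eccV≤ = ≤-trans (A.CG.eccV-≤-dist+eccV x w) (+-monoʳ-≤ (dist G x w) R≤p)

  eccFormula-vP-≤ : ∀ a → A.eccFormula (vP a) ≤ B.eccFormula (vP (Fin.suc a))
  eccFormula-vP-≤ a = ⊔-lub (B.≤eccFormula-vP-R (Fin.suc a) (n≤1+n (i + R)))
    (⊔-lub (B.≤eccFormula-vP-Q (Fin.suc a) (≤-reflexive (+-suc i q)))
           (B.≤eccFormula-vP-P (Fin.suc a) ≤-refl))
    where i = suc (toℕ a)

  eccFormula-vP-< : p < R → ∀ a → A.eccFormula (vP a) < B.eccFormula (vP (Fin.suc a))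
  eccFormula-vP-< p<R a = B.≤eccFormula-vP-R (Fin.suc a) (s≤s (⊔-lub ≤-refl (⊔-lub viaQ viaP)))
    where
    i = suc (toℕ a)
    viaQ : i + suc q ≤ i + R
    viaQ = +-monoʳ-≤ i (≤-trans q<p (<⇒≤ p<R))
    viaP : p ∸ i ≤ i + R
    viaP = ≤-trans (m∸n≤m p i) (≤-trans (<⇒≤ p<R) (m≤n+m R i))

  eccFormula-vQ-≤suc : ∀ b → A.eccFormula (vQ (Fin.suc b)) ≤ suc (B.eccFormula (vQ b))
  eccFormula-vQ-≤suc b = +-monoʳ-≤ (suc (suc (toℕ b))) (⊔-monoʳ-≤ R (n≤1+n p))

  eccFormula-vQ-≤ : R ≤ p → ∀ b → A.eccFormula (vQ (Fin.suc b)) ≤ B.eccFormula (vQ b)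
  eccFormula-vQ-≤ R≤p b = ≤-reflexive (begin
    suc (suc (toℕ b)) + (R ⊔ p)   ≡⟨ cong (suc (suc (toℕ b)) +_) (m≤n⇒m⊔n≡n R≤p) ⟩
    suc (suc (toℕ b)) + p         ≡⟨ +-suc (suc (toℕ b)) p ⟨
    suc (toℕ b) + suc p           ≡⟨ cong (suc (toℕ b) +_) (m≤n⇒m⊔n≡n (m≤n⇒m≤1+n R≤p)) ⟨
    suc (toℕ b) + (R ⊔ suc p)     ∎)
    where open ≡-Reasoning

  eccFormula-u₁ : ℕ
  eccFormula-u₁ = A.eccFormula (vQ Fin.zero)

  eccFormula-v₁ : ℕ
  eccFormula-v₁ = B.eccFormula (vP Fin.zero)

  formulaSum-< : 2 ≤ n G → A.formulaSum < B.formulaSum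
  formulaSum-< 2≤n with R ≤? p
  ... | yes R≤p = +-<-blocks (n G) 0 0
    (∑-<-pointwise (eccFormula-old-< R≤p))
    (≤-trans (≤-reflexive (+-identityʳ _)) (∑-mono-≤ eccFormula-vP-≤))
    (≤-trans (∑-mono-≤ (eccFormula-vQ-≤ R≤p)) (≤-reflexive (sym (+-identityʳ _))))
    (begin-strict
      eccFormula-u₁ + 0       ≡⟨ +-identityʳ eccFormula-u₁ ⟩
      suc (R ⊔ p)             ≡⟨ cong suc (m≤n⇒m⊔n≡n R≤p) ⟩
      suc p                   <⟨ +-mono-≤ 2≤n (B.≤eccFormula-vP-P Fin.zero ≤-refl) ⟩
      n G + eccFormula-v₁     ≡⟨ cong (_+ eccFormula-v₁) (+-identityʳ (n G)) ⟨
      n G + 0 + eccFormula-v₁ ∎)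
    where open ≤-Reasoning
  ... | no  R≰p = +-<-blocks 0 p q
    (≤-trans (≤-reflexive (+-identityʳ _)) (∑-mono-≤ eccFormula-old-≤))
    (∑-<-pointwise (eccFormula-vP-< p<R))
    (∑-≤-suc-pointwise eccFormula-vQ-≤suc)
    (begin-strict
      eccFormula-u₁ + q ≡⟨ cong (λ m → suc m + q) (m≥n⇒m⊔n≡m (<⇒≤ p<R)) ⟩
      suc R + q         <⟨ +-monoʳ-< (suc R) q<p ⟩
      suc R + p         ≤⟨ +-monoˡ-≤ p (B.≤eccFormula-vP-R Fin.zero ≤-refl) ⟩
      eccFormula-v₁ + p ≡⟨ +-comm eccFormula-v₁ p ⟩
      p + eccFormula-v₁ ∎)
    where
    open ≤-Reasoning
    p<R : p < R
    p<R = ≰⇒> R≰p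

  eccSum-< : 2 ≤ n G → A.eccSum < B.eccSum
  eccSum-< 2≤n = begin-strict
    A.eccSum     ≤⟨ A.eccSum-≤-formulaSum q<p ⟩
    A.formulaSum <⟨ formulaSum-< 2≤n ⟩
    B.formulaSum ≤⟨ B.formulaSum-≤-eccSum (≤-trans (<⇒≤ q<p) (n≤1+n p)) z<s ⟩
    B.eccSum     ∎
    where open ≤-Reasoning

divℕ-<-numerator : ∀ {s s′ m} → 0 < m → s < s′ → divℕ s m ℚ.< divℕ s′ m
divℕ-<-numerator {s} {s′} {suc m} _ s<s′ = ℚₚ.toℚᵘ-cancel-<
  (ℚᵘₚ.<-respʳ-≃ (ℚᵘₚ.≃-sym (ℚₚ.toℚᵘ-fromℚᵘ (mkℚᵘ (ℤ.+ s′) m)))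
  (ℚᵘₚ.<-respˡ-≃ (ℚᵘₚ.≃-sym (ℚₚ.toℚᵘ-fromℚᵘ (mkℚᵘ (ℤ.+ s) m))) (*<* cross)))
  where
  cross : ℤ.+ s ℤ.* ℤ.+ suc m ℤ.< ℤ.+ s′ ℤ.* ℤ.+ suc m
  cross = subst₂ ℤ._<_ (ℤₚ.pos-* s (suc m)) (ℤₚ.pos-* s′ (suc m)) (ℤ.+<+ (*-monoˡ-< (suc m) s<s′))

mainTheorem1 : (G : Graph) → Simple G → Connected G → 2 ≤ n G →
    (w : Fin (n G)) → (p q : ℕ) → q ≤ p → 1 ≤ q →
    ecc (attach G w p q) ℚ.< ecc (attach G w (suc p) (q ∸ 1))
mainTheorem1 G _ conn 2≤n w p (suc q) q<p _ =
  subst (λ m → ecc (attach G w p (suc q)) ℚ.< divℕ T.B.eccSum (n G + m)) (+-suc p q)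
    (divℕ-<-numerator (≤-trans (s≤s z≤n) (≤-trans 2≤n (m≤m+n (n G) _))) (T.eccSum-< 2≤n))
  where module T = PendantShift G conn w p q q<p
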